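{- For an incidence hypergraph $G$, let $\mathscr{F}(G)$ be the set-system hypergraph with $V(\mathscr{F}(G))=\check V(G)$, $E(\mathscr{F}(G))=\check E(G)$ and $\epsilon_{\mathscr{F}(G)}(e)=\{v\in\check V(G):\varsigma_G^{ -1}(v)\cap\omega_G^{ -1}(e)\neq\emptyset\}$. There is no functor $\mathfrak{R}\to\mathfrak{H}$ whose action on objects is $G\mapsto\mathscr{F}(G)$.
   Context: A set-system hypergraph $G$ consists of sets $V(G)$, $E(G)$ and $\epsilon_G:E(G)\to\mathcal{P}(V(G))$; morphisms are pairs $(E(\phi),V(\phi))$ with $\epsilon_H\circ E(\phi)=\mathcal{P}V(\phi)\circ\epsilon_G$ ($\mathcal{P}f(A)$ the image); category $\mathfrak{H}$. An incidence hypergraph $G$ consists of sets $\check V(G)$, $\check E(G)$, $I(G)$ and functions $\varsigma_G:I(G)\to\check V(G)$, $\omega_G:I(G)\to\check E(G)$; a morphism is a triple of functions $\check V(\phi),\check E(\phi),I(\phi)$ with $\varsigma_H\circ I(\phi)=\check V(\phi)\circ\varsigma_G$ and $\omega_H\circ I(\phi)=\check E(\phi)\circ\omega_G$; category $\mathfrak{R}$. -}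

module Defs where

open import Data.Product using (Σ; _×_; _,_)
open import Function.Bundles using (_⇔_)
open import Relation.Binary.PropositionalEquality using (_≡_)
open import Function using (id; _∘_)

-- Subsets of a set X are predicates X → Set; equality of subsets is
-- extensional (mutual inclusion).
𝒫 : Set → Set₁
𝒫 X = X → Set

image : {X Y : Set} → (X → Y) → 𝒫 X → 𝒫 Y
image {X} f A y = Σ X (λ x → A x × (f x ≡ y))

record SetSystem : Set₁ where
  field
    V : Set
    E : Set
    ε : E → 𝒫 V
open SetSystem public

record SSMor (G H : SetSystem) : Set₁ where
  field
    Vm : V G → V H
    Em : E G → E H
    comm : ∀ e v → ε H (Em e) v ⇔ image Vm (ε G e) v
open SSMor public

_≈S_ : {G H : SetSystem} → SSMor G H → SSMor G H → Set
φ ≈S ψ = (∀ v → Vm φ v ≡ Vm ψ v) × (∀ e → Em φ e ≡ Em ψ e)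

record IncHyp : Set₁ where
  field
    Vˇ : Set
    Eˇ : Set
    I  : Set
    ς  : I → Vˇ
    ω  : I → Eˇ
open IncHyp public

record IncMor (G H : IncHyp) : Set where
  field
    Vmˇ : Vˇ G → Vˇ H
    Emˇ : Eˇ G → Eˇ H
    Im  : I G → I H
    commς : ∀ i → ς H (Im i) ≡ Vmˇ (ς G i)
    commω : ∀ i → ω H (Im i) ≡ Emˇ (ω G i)
open IncMor public

idI : (G : IncHyp) → IncMor G G
idI G = record { Vmˇ = id ; Emˇ = id ; Im = id
               ; commς = λ i → Relation.Binary.PropositionalEquality.refl
               ; commω = λ i → Relation.Binary.PropositionalEquality.refl }

_∘I_ : {G H K : IncHyp} → IncMor H K → IncMor G H → IncMor G K
_∘I_ {G} {H} {K} ψ φ = record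
  { Vmˇ = Vmˇ ψ ∘ Vmˇ φ ; Emˇ = Emˇ ψ ∘ Emˇ φ ; Im = Im ψ ∘ Im φ
  ; commς = λ i → trans (commς ψ (Im φ i)) (cong (Vmˇ ψ) (commς φ i))
  ; commω = λ i → trans (commω ψ (Im φ i)) (cong (Emˇ ψ) (commω φ i)) }
  where open Relation.Binary.PropositionalEquality using (trans; cong)

idS : (G : SetSystem) → SSMor G G
idS G = record { Vm = id ; Em = id
               ; comm = λ e v → record
                   { to = λ a → v , a , Relation.Binary.PropositionalEquality.refl
                   ; from = λ { (x , a , Relation.Binary.PropositionalEquality.refl) → a }
                   ; to-cong = λ { Relation.Binary.PropositionalEquality.refl → Relation.Binary.PropositionalEquality.refl }
                   ; from-cong = λ { Relation.Binary.PropositionalEquality.refl → Relation.Binary.PropositionalEquality.refl } } }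

_∘S_ : {G H K : SetSystem} → SSMor H K → SSMor G H → SSMor G K
_∘S_ {G} {H} {K} ψ φ = record
  { Vm = Vm ψ ∘ Vm φ ; Em = Em ψ ∘ Em φ
  ; comm = λ e v → record
      { to = λ k → let (w , hw , p) = Equivalence.to (comm ψ (Em φ e) v) k
                       (x , gx , q) = Equivalence.to (comm φ e w) hw
                   in x , gx , trans (cong (Vm ψ) q) p
      ; from = λ { (x , gx , p) → Equivalence.from (comm ψ (Em φ e) v)
                     (Vm φ x , Equivalence.from (comm φ e (Vm φ x)) (x , gx , refl) , p) }
      ; to-cong = λ { refl → refl } ; from-cong = λ { refl → refl } } }
  where open Relation.Binary.PropositionalEquality using (trans; cong; refl)
        open Function.Bundles using (Equivalence)

𝓕 : IncHyp → SetSystem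
𝓕 G = record { V = Vˇ G ; E = Eˇ G
             ; ε = λ e v → Σ (I G) (λ i → (ς G i ≡ v) × (ω G i ≡ e)) }

record FunctorOn𝓕 : Set₁ where
  field
    F₁ : {G H : IncHyp} → IncMor G H → SSMor (𝓕 G) (𝓕 H)
    F-id : (G : IncHyp) → F₁ (idI G) ≈S idS (𝓕 G)
    F-∘ : {G H K : IncHyp} (ψ : IncMor H K) (φ : IncMor G H) →
          F₁ (ψ ∘I φ) ≈S (F₁ ψ ∘S F₁ φ)

-- Idea: a morphism of set-system hypergraphs must send every empty edge to
-- an empty edge, since ε_H(E(φ) e) is the image of ε_G(e) and the image of
-- the empty set is empty.  Morphisms of incidence hypergraphs carry no such
-- constraint: an edge with no incidences may be mapped onto an edge that has
-- one.  Under 𝓕 an edge without incidences becomes an empty edge and an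
-- edge with an incidence becomes a nonempty one, so such an incidence
-- morphism has no possible image under a functor extending 𝓕.
module Submission where

open import Defs
open import Relation.Nullary using (¬_)
open import Data.Unit using (⊤; tt)
open import Data.Empty using (⊥)
open import Data.Product using (_,_)
open import Function using (id)
open import Function.Bundles using (Equivalence)
open import Relation.Binary.PropositionalEquality using (refl)

EmptyEdge : (G : SetSystem) → E G → Set
EmptyEdge G e = ∀ v → ¬ ε G e v

morphism-preserves-empty : {G H : SetSystem} (φ : SSMor G H) (e : E G) →
                           EmptyEdge G e → EmptyEdge H (Em φ e)
morphism-preserves-empty φ e empty v v∈φe
  with Equivalence.to (comm φ e v) v∈φe
... | (x , x∈e , _) = empty x x∈e

no-morphism-to-nonempty : {G H : SetSystem} (e : E G) → EmptyEdge G e →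
                          (∀ f → ¬ EmptyEdge H f) → ¬ SSMor G H
no-morphism-to-nonempty e empty nonempty φ =
  nonempty (Em φ e) (morphism-preserves-empty φ e empty)

loose : IncHyp
loose = record { Vˇ = ⊤ ; Eˇ = ⊤ ; I = ⊥ ; ς = λ () ; ω = λ () }

loose-edge-empty : EmptyEdge (𝓕 loose) tt
loose-edge-empty _ (() , _)

incident : IncHyp
incident = record { Vˇ = ⊤ ; Eˇ = ⊤ ; I = ⊤ ; ς = λ _ → tt ; ω = λ _ → tt }

incident-edges-nonempty : ∀ e → ¬ EmptyEdge (𝓕 incident) e
incident-edges-nonempty tt empty = empty tt (tt , refl , refl)

inclusion : IncMor loose incident
inclusion = record { Vmˇ = id ; Emˇ = id ; Im = λ ()
                   ; commς = λ () ; commω = λ () }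

mainTheorem14 : ¬ FunctorOn𝓕
mainTheorem14 F =
  no-morphism-to-nonempty tt loose-edge-empty incident-edges-nonempty
    (FunctorOn𝓕.F₁ F inclusion)
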